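{- Let $D$ be a nonzero integer and suppose $(x,y,p)$ is a solution of $x^2 + D = y^p$ in integers $x,y$ with $p\ge 3$ prime, such that $y\neq 0$ and $p$ satisfies: $p\ge 7$; $p \geq v_q(D)+1$ for all primes $q$; and $p \geq v_2(D)+7$ if $v_2(D)$ is even. Then there are integers $d_1, d_2$ such that (i) $d_1>0$; (ii) $D = d_1^2 d_2$; (iii) $\gcd(d_1,d_2)=1$; (iv) for all odd primes $q \mid d_1$ the Legendre symbol $\left(\frac{ -d_2}{q}\right) = 1$; (v) if $2\mid d_1$ then $d_2 \equiv 7 \pmod 8$. Moreover there are integers $s,t$ such that $x = d_1 t$, $y = \mathrm{rad}(d_1)\, s$, and \[ t^2 + d_2 = e s^p, \qquad \gcd(t,d_2)=1, \qquad s \neq 0, \] where $e = \prod_{q \text{ prime},\ q\mid d_1} q^{\,p - 2 v_q(d_1)}$ is an integer, and $\mathrm{rad}(e) = \mathrm{rad}(d_1)$.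
   Context: For a prime $q$, $v_q$ denotes the normalized $q$-adic valuation. For a nonzero integer $a$, $\mathrm{rad}(a)$ is the product of the distinct primes dividing $a$ (so $\mathrm{rad}(1)=1$). -}

module Defs where

open import Data.Nat as ℕ using (ℕ; zero; suc; _∸_; _≤?_)
open import Data.Nat.Divisibility as ℕD using (_∣?_)
open import Data.Nat.Primality using (Prime; prime?)
open import Data.Integer as ℤ using (ℤ; +_; ∣_∣)
open import Data.Integer.Divisibility as ℤD using ()
open import Data.List using (List; filter; upTo; foldr; map)
open import Data.Product using (Σ; _×_)
open import Relation.Nullary using (¬_; yes; no)
open import Relation.Nullary.Decidable using (_×-dec_)

prodℕ : List ℕ → ℕ
prodℕ = foldr ℕ._*_ 1

-- q-adic valuation on ℕ: the number of times q divides n (computed with fuel n,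
-- which suffices for q ≥ 2 and n > 0). Only meaningful for q ≥ 2, n ≠ 0.
vAux : ℕ → ℕ → ℕ → ℕ
vAux zero q n = 0
vAux (suc f) zero n = 0
vAux (suc f) (suc zero) n = 0
vAux (suc f) (suc (suc k)) n with suc (suc k) ∣? n
... | yes _ = suc (vAux f (suc (suc k)) (n ℕ./ suc (suc k)))
... | no _ = 0

vℕ : ℕ → ℕ → ℕ
vℕ q n = vAux n q n

v : ℕ → ℤ → ℕ
v q a = vℕ q ∣ a ∣

-- the list of primes dividing n (for n ≠ 0 they are all ≤ n)
primeDivisors : ℕ → List ℕ
primeDivisors n = filter (λ q → prime? q ×-dec q ∣? n) (upTo (suc n))

rad : ℤ → ℕ
rad a = prodℕ (primeDivisors ∣ a ∣)

-- e = ∏_{q prime, q ∣ d₁} q ^ (p - 2 v_q(d₁))   (natural subtraction; the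
-- statement separately asserts 2 v_q(d₁) ≤ p, i.e. that e is an integer)
eConst : ℕ → ℤ → ℕ
eConst p d₁ = prodℕ (map (λ q → q ℕ.^ (p ∸ 2 ℕ.* v q d₁)) (primeDivisors ∣ d₁ ∣))

-- Legendre symbol (a / q) = 1 for an odd prime q: q ∤ a and a is a nonzero
-- quadratic residue modulo q.
LegendreIsOne : ℤ → ℕ → Set
LegendreIsOne a q = ¬ ((+ q) ℤD.∣ a) × Σ ℤ (λ z → (+ q) ℤD.∣ (z ℤ.* z ℤ.- a))

module Submission where

-- For every prime r ∣ y we have v_r(D) < p ≤ v_r(yᵖ), so x² = yᵖ − D has v_r(x²) = v_r(D); in
-- particular v_r(D) is even. Hence d₁ = ∏_{r ∣ y} r^(v_r(D)/2) satisfies d₁² ∣ D and d₁ ∣ x, and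
-- no prime of y divides d₂ = D/d₁². Comparing valuations gives rad(d₁)ᵖ = d₁² e, so dividing
-- x² + D = yᵖ by d₁² yields t² + d₂ = e sᵖ with x = d₁ t and y = rad(d₁) s. Every prime q of d₁
-- divides e and hence t² + d₂, which gives the Legendre symbol; for q = 2 the hypothesis on v₂(D)
-- makes 8 ∣ e, and an odd d₂ with t² + d₂ ≡ 0 (mod 8) is ≡ 7 (mod 8).

module Valuation where

  open import Data.Nat.Base
  open import Data.Nat.Properties
  open import Data.Nat.Divisibility
  open import Data.Nat.DivMod using (m/n<m; m/n*n≡m)
  open import Data.Nat.ListAction using (product)
  open import Data.Nat.Primality
  open import Data.Nat.Primality.Factorisation using (factorise; PrimeFactorisation)
  open import Data.Nat.Coprimality using (Coprime)
  open import Data.Nat.Tactic.RingSolver using (solve-∀)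
  open import Data.List.Base using ([]; _∷_)
  open import Data.List.Relation.Unary.All using (All; []; _∷_)
  open import Data.Product using (Σ; _×_; _,_)
  open import Data.Sum using (inj₁; inj₂; [_,_]′)
  open import Relation.Nullary using (¬_; yes; no)
  open import Relation.Nullary.Negation using (contradiction)
  open import Relation.Binary.PropositionalEquality
  open import Relation.Binary.Definitions using (tri<; tri≈; tri>)
  open import Defs using (vAux; vℕ)

  record IsValuation (q n k : ℕ) : Set where
    constructor isValuation
    field
      power∣     : q ^ k ∣ n
      nextPower∤ : ¬ (q ^ suc k ∣ n)

  open IsValuation

  *-pos : ∀ {m n} → 0 < m → 0 < n → 0 < m * n
  *-pos {suc m} {suc n} _ _ = z<s

  prime>0 : ∀ {q} → Prime q → 0 < q
  prime>0 {suc q} _ = z<s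

  ^-pos : ∀ {m} n → 0 < m → 0 < m ^ n
  ^-pos {suc m} n _ = m^n>0 (suc m) n

  ^-monoʳ-∣ : ∀ q {i j} → i ≤ j → q ^ i ∣ q ^ j
  ^-monoʳ-∣ q {i} {j} i≤j with k , refl ← m≤n⇒∃[o]m+o≡n i≤j =
    subst (q ^ i ∣_) (sym (^-distribˡ-+-* q i k)) (m∣m*n (q ^ k))

  ^-monoˡ-∣ : ∀ {a b} k → a ∣ b → a ^ k ∣ b ^ k
  ^-monoˡ-∣ zero    a∣b = ∣-refl
  ^-monoˡ-∣ (suc k) a∣b = *-pres-∣ a∣b (^-monoˡ-∣ k a∣b)

  prime∣^⇒∣ : ∀ {q m} k → Prime q → q ∣ m ^ k → q ∣ m
  prime∣^⇒∣ zero    pq q∣1 = contradiction (subst Prime (∣1⇒≡1 q∣1) pq) ¬prime[1]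
  prime∣^⇒∣ {m = m} (suc k) pq q∣m^k+1 with euclidsLemma m (m ^ k) pq q∣m^k+1
  ... | inj₁ q∣m   = q∣m
  ... | inj₂ q∣m^k = prime∣^⇒∣ k pq q∣m^k

  vAux-isValuation : ∀ fuel k n → 0 < n → n ≤ fuel → IsValuation (2 + k) n (vAux fuel (2 + k) n)
  vAux-isValuation zero k n 0<n n≤0 = contradiction (≤-trans 0<n n≤0) λ ()
  vAux-isValuation (suc fuel) k n 0<n n≤1+fuel with 2 + k ∣? n
  ... | no q∤n = isValuation (1∣ n) λ q∣n → q∤n (subst (_∣ n) (*-identityʳ (2 + k)) q∣n)
  ... | yes q∣n = isValuation (subst (q ^ suc j ∣_) (sym n≡q*m) (*-monoʳ-∣ q (power∣ ih)))
                    λ q^j+2∣n → nextPower∤ ih (*-cancelˡ-∣ q (subst (q ^ suc (suc j) ∣_) n≡q*m q^j+2∣n))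
    where
    q = 2 + k
    m = n / q
    n≡q*m : n ≡ q * m
    n≡q*m = trans (sym (m/n*n≡m q∣n)) (*-comm m q)
    0<m : 0 < m
    0<m = n≢0⇒n>0 λ m≡0 → >⇒≢ 0<n (trans n≡q*m (trans (cong (q *_) m≡0) (*-zeroʳ q)))
    ih : IsValuation q m (vAux fuel q m)
    ih = vAux-isValuation fuel k m 0<m (≤-pred (≤-trans (m/n<m n q {{>-nonZero 0<n}} (s≤s (s≤s z≤n))) n≤1+fuel))
    j = vAux fuel q m

  vℕ-isValuation : ∀ {q n} → Prime q → 0 < n → IsValuation q n (vℕ q n)
  vℕ-isValuation {0}           pq = contradiction pq ¬prime[0]
  vℕ-isValuation {1}           pq = contradiction pq ¬prime[1]
  vℕ-isValuation {2+ k} {n} _ 0<n = vAux-isValuation n k n 0<n ≤-refl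

  isValuation-unique : ∀ {q n a b} → IsValuation q n a → IsValuation q n b → a ≡ b
  isValuation-unique {q} {a = a} {b} (isValuation q^a∣n q^a+1∤n) (isValuation q^b∣n q^b+1∤n) with <-cmp a b
  ... | tri< a<b _ _ = contradiction (∣-trans (^-monoʳ-∣ q a<b) q^b∣n) q^a+1∤n
  ... | tri≈ _ a≡b _ = a≡b
  ... | tri> _ _ b<a = contradiction (∣-trans (^-monoʳ-∣ q b<a) q^a∣n) q^b+1∤n

  vℕ-unique : ∀ {q n k} → Prime q → 0 < n → IsValuation q n k → vℕ q n ≡ k
  vℕ-unique pq 0<n = isValuation-unique (vℕ-isValuation pq 0<n)

  ¬isValuation[0] : ∀ {q k} → ¬ IsValuation q 0 k
  ¬isValuation[0] (isValuation _ q^k+1∤0) = q^k+1∤0 (_ ∣0)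

  isValuation⇒cofactor : ∀ {q n k} → IsValuation q n k → Σ ℕ λ c → n ≡ c * q ^ k × ¬ (q ∣ c)
  isValuation⇒cofactor {q} {k = k} (isValuation (divides c n≡c*q^k) q^k+1∤n) =
    c , n≡c*q^k , λ { (divides c′ c≡c′*q) → q^k+1∤n (divides c′ (begin
      _              ≡⟨ n≡c*q^k ⟩
      c * q ^ k      ≡⟨ cong (_* q ^ k) c≡c′*q ⟩
      c′ * q * q ^ k ≡⟨ *-assoc c′ q (q ^ k) ⟩
      c′ * q ^ suc k ∎)) }
    where open ≡-Reasoning

  isValuation-* : ∀ {q m n a b} → Prime q → IsValuation q m a → IsValuation q n b → IsValuation q (m * n) (a + b)
  isValuation-* {q} {m} {n} {a} {b} pq vm vn
    with c , m≡c*q^a , q∤c ← isValuation⇒cofactor vm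
       | d , n≡d*q^b , q∤d ← isValuation⇒cofactor vn = isValuation (divides (c * d) mn≡) q^a+b+1∤mn
    where
    mn≡ : m * n ≡ c * d * q ^ (a + b)
    mn≡ = begin
      m * n                     ≡⟨ cong₂ _*_ m≡c*q^a n≡d*q^b ⟩
      c * q ^ a * (d * q ^ b)   ≡⟨ rearrange c (q ^ a) d (q ^ b) ⟩
      c * d * (q ^ a * q ^ b)   ≡⟨ cong (c * d *_) (sym (^-distribˡ-+-* q a b)) ⟩
      c * d * q ^ (a + b)       ∎
      where
      open ≡-Reasoning
      rearrange : ∀ w x y z → w * x * (y * z) ≡ w * y * (x * z)
      rearrange = solve-∀
    q^a+b+1∤mn : ¬ (q ^ suc (a + b) ∣ m * n)
    q^a+b+1∤mn q^a+b+1∣mn =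
      [ q∤c , q∤d ]′ (euclidsLemma c d pq (*-cancelʳ-∣ (q ^ (a + b)) {{m^n≢0 q (a + b) {{prime⇒nonZero pq}}}}
                        (subst (q ^ suc (a + b) ∣_) mn≡ q^a+b+1∣mn)))

  vℕ-* : ∀ {q m n} → Prime q → 0 < m → 0 < n → vℕ q (m * n) ≡ vℕ q m + vℕ q n
  vℕ-* pq 0<m 0<n = vℕ-unique pq (*-pos 0<m 0<n) (isValuation-* pq (vℕ-isValuation pq 0<m) (vℕ-isValuation pq 0<n))

  vℕ[1]≡0 : ∀ {q} → Prime q → vℕ q 1 ≡ 0
  vℕ[1]≡0 pq = vℕ-unique pq z<s (isValuation ∣-refl λ q∣1 →
    ¬prime[1] (subst Prime (∣1⇒≡1 (∣-trans (m∣m*n 1) q∣1)) pq))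

  vℕ-^ : ∀ {q m} k → Prime q → 0 < m → vℕ q (m ^ k) ≡ k * vℕ q m
  vℕ-^ zero          pq 0<m = vℕ[1]≡0 pq
  vℕ-^ {q} {m} (suc k) pq 0<m = trans (vℕ-* pq 0<m (^-pos k 0<m)) (cong (vℕ q m +_) (vℕ-^ k pq 0<m))

  ^∣⇒≤vℕ : ∀ {q n k} → Prime q → 0 < n → q ^ k ∣ n → k ≤ vℕ q n
  ^∣⇒≤vℕ {q} {n} {k} pq 0<n q^k∣n with k ≤? vℕ q n
  ... | yes k≤v = k≤v
  ... | no  k≰v = contradiction (∣-trans (^-monoʳ-∣ q (≰⇒> k≰v)) q^k∣n) (nextPower∤ (vℕ-isValuation pq 0<n))

  ≤vℕ⇒^∣ : ∀ {q n k} → Prime q → 0 < n → k ≤ vℕ q n → q ^ k ∣ n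
  ≤vℕ⇒^∣ {q} pq 0<n k≤v = ∣-trans (^-monoʳ-∣ q k≤v) (power∣ (vℕ-isValuation pq 0<n))

  ∣⇒vℕ>0 : ∀ {q n} → Prime q → 0 < n → q ∣ n → 0 < vℕ q n
  ∣⇒vℕ>0 {q} pq 0<n q∣n = ^∣⇒≤vℕ pq 0<n (subst (_∣ _) (sym (*-identityʳ q)) q∣n)

  vℕ>0⇒∣ : ∀ {q n} → Prime q → 0 < n → 0 < vℕ q n → q ∣ n
  vℕ>0⇒∣ {q} pq 0<n v>0 = subst (_∣ _) (*-identityʳ q) (≤vℕ⇒^∣ pq 0<n v>0)

  ∤⇒vℕ≡0 : ∀ {q n} → Prime q → 0 < n → ¬ (q ∣ n) → vℕ q n ≡ 0
  ∤⇒vℕ≡0 pq 0<n q∤n = n≤0⇒n≡0 (≮⇒≥ λ v>0 → q∤n (vℕ>0⇒∣ pq 0<n v>0))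

  vℕ≡0⇒∤ : ∀ {q n} → Prime q → 0 < n → vℕ q n ≡ 0 → ¬ (q ∣ n)
  vℕ≡0⇒∤ pq 0<n v≡0 q∣n = >⇒≢ (∣⇒vℕ>0 pq 0<n q∣n) v≡0

  vℕ-self : ∀ {q} → Prime q → vℕ q q ≡ 1
  vℕ-self {q} pq = vℕ-unique pq (prime>0 pq) (isValuation q^1∣q q^2∤q)
    where
    instance _ = prime⇒nonZero pq
    q^1∣q : q ^ 1 ∣ q
    q^1∣q = ∣-reflexive (*-identityʳ q)
    q^2∤q : ¬ (q ^ 2 ∣ q)
    q^2∤q q^2∣q = ¬prime[1] (subst Prime (∣1⇒≡1 (subst (_∣ 1) (*-identityʳ q)
                    (*-cancelˡ-∣ q (subst (q ^ 2 ∣_) (sym (*-identityʳ q)) q^2∣q)))) pq)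

  vℕ-other : ∀ {q r} → Prime q → Prime r → q ≢ r → vℕ q r ≡ 0
  vℕ-other pq pr q≢r = ∤⇒vℕ≡0 pq (prime>0 pr) λ q∣r →
    [ (λ q≡1 → ¬prime[1] (subst Prime q≡1 pq)) , q≢r ]′ (prime⇒irreducible pr q∣r)

  ∣-by-vℕ-product : ∀ {qs n} → All Prime qs → 0 < n →
                    (∀ r → Prime r → vℕ r (product qs) ≤ vℕ r n) → product qs ∣ n
  ∣-by-vℕ-product {[]}     []           _   _  = 1∣ _
  ∣-by-vℕ-product {q ∷ qs} {n} (pq ∷ pqs) 0<n le =
    subst (q * product qs ∣_) (sym n≡q*n′) (*-monoʳ-∣ q (∣-by-vℕ-product pqs 0<n′ le′))
    where
    0<q = prime>0 pq
    0<∏qs = productOfPrimes≥1 pqs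
    q∣n : q ∣ n
    q∣n = vℕ>0⇒∣ pq 0<n (≤-trans (subst (_≤ vℕ q q + vℕ q (product qs)) (vℕ-self pq) (m≤m+n _ _))
                                 (subst (_≤ vℕ q n) (vℕ-* pq 0<q 0<∏qs) (le q pq)))
    n′ = quotient q∣n
    n≡q*n′ : n ≡ q * n′
    n≡q*n′ = m∣n⇒n≡m*quotient q∣n
    0<n′ : 0 < n′
    0<n′ = n≢0⇒n>0 λ n′≡0 → >⇒≢ 0<n (trans n≡q*n′ (trans (cong (q *_) n′≡0) (*-zeroʳ q)))
    le′ : ∀ r → Prime r → vℕ r (product qs) ≤ vℕ r n′
    le′ r pr = +-cancelˡ-≤ (vℕ r q) _ _ (subst₂ _≤_ (vℕ-* pr 0<q 0<∏qs)
                 (trans (cong (vℕ r) n≡q*n′) (vℕ-* pr 0<q 0<n′)) (le r pr))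

  ∣-by-vℕ : ∀ {m n} → 0 < m → 0 < n → (∀ r → Prime r → vℕ r m ≤ vℕ r n) → m ∣ n
  ∣-by-vℕ {m} {n} 0<m 0<n le = subst (_∣ n) (sym m≡∏) (∣-by-vℕ-product factorsPrime 0<n
                                   (subst (λ k → ∀ r → Prime r → vℕ r k ≤ vℕ r n) m≡∏ le))
    where open PrimeFactorisation (factorise m {{>-nonZero 0<m}}) renaming (isFactorisation to m≡∏)

  ≡-by-vℕ : ∀ {m n} → 0 < m → 0 < n → (∀ r → Prime r → vℕ r m ≡ vℕ r n) → m ≡ n
  ≡-by-vℕ 0<m 0<n eq = ∣-antisym (∣-by-vℕ 0<m 0<n λ r pr → ≤-reflexive (eq r pr))
                                 (∣-by-vℕ 0<n 0<m λ r pr → ≤-reflexive (sym (eq r pr)))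

  no-common-prime⇒coprime : ∀ {m n} → 0 < m → (∀ r → Prime r → r ∣ m → ¬ (r ∣ n)) → Coprime m n
  no-common-prime⇒coprime {m} {n} 0<m disjoint {d} (d∣m , d∣n) =
    ∣1⇒≡1 (∣-by-vℕ 0<d z<s λ r pr → ≤-trans (≤-reflexive (vℕ-d≡0 r pr)) z≤n)
    where
    0<d : 0 < d
    0<d = n≢0⇒n>0 λ { refl → >⇒≢ 0<m (0∣⇒≡0 d∣m) }
    vℕ-d≡0 : ∀ r → Prime r → vℕ r d ≡ 0
    vℕ-d≡0 r pr = ∤⇒vℕ≡0 pr 0<d λ r∣d → disjoint r pr (∣-trans r∣d d∣m) (∣-trans r∣d d∣n)

module PrimeDivisorProducts where

  open import Data.Nat.Base
  open import Data.Nat.Properties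
  open import Data.Nat.Divisibility
  open import Data.Nat.Primality
  open import Data.Integer.Base using (+_)
  open import Data.List.Base using (List; _∷_; map; upTo)
  open import Data.List.Properties using (map-id; map-cong)
  open import Data.List.Membership.Propositional using (_∈_; _∉_)
  open import Data.List.Membership.Propositional.Properties using (∈-filter⁺; ∈-filter⁻; ∈-upTo⁺)
  open import Data.List.Relation.Unary.All as All using (All; []; _∷_)
  open import Data.List.Relation.Unary.All.Properties using (all-filter)
  open import Data.List.Relation.Unary.Any using (here; there)
  open import Data.List.Relation.Unary.Unique.Propositional using (Unique; _∷_)
  import Data.List.Relation.Unary.Unique.Propositional.Properties as Unique
  open import Data.Product using (_,_; proj₁; proj₂)
  open import Relation.Nullary using (¬_; yes; no)
  open import Relation.Nullary.Decidable using (_×-dec_)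
  open import Relation.Binary.PropositionalEquality
  open import Function.Base using (_∘_)
  open import Defs using (vℕ; prodℕ; primeDivisors; rad)
  open Valuation

  vℕ-self-^ : ∀ {q} k → Prime q → vℕ q (q ^ k) ≡ k
  vℕ-self-^ {q} k pq = trans (vℕ-^ k pq (prime>0 pq)) (trans (cong (k *_) (vℕ-self pq)) (*-identityʳ k))

  vℕ-other-^ : ∀ {q r} k → Prime q → Prime r → q ≢ r → vℕ q (r ^ k) ≡ 0
  vℕ-other-^ k pq pr q≢r = trans (vℕ-^ k pq (prime>0 pr)) (trans (cong (k *_) (vℕ-other pq pr q≢r)) (*-zeroʳ k))

  module _ (g : ℕ → ℕ) where

    powProduct : List ℕ → ℕ
    powProduct qs = prodℕ (map (λ q → q ^ g q) qs)

    powProduct-pos : ∀ {qs} → All Prime qs → 0 < powProduct qs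
    powProduct-pos []         = z<s
    powProduct-pos {q ∷ _} (pq ∷ pqs) = *-pos (^-pos (g q) (prime>0 pq)) (powProduct-pos pqs)

    vℕ-powProduct-∉ : ∀ {r qs} → Prime r → All Prime qs → r ∉ qs → vℕ r (powProduct qs) ≡ 0
    vℕ-powProduct-∉ pr [] _ = vℕ[1]≡0 pr
    vℕ-powProduct-∉ {r} {q ∷ qs} pr (pq ∷ pqs) r∉q∷qs = begin
      vℕ r (q ^ g q * powProduct qs)           ≡⟨ vℕ-* pr (^-pos (g q) (prime>0 pq)) (powProduct-pos pqs) ⟩
      vℕ r (q ^ g q) + vℕ r (powProduct qs)    ≡⟨ cong₂ _+_ (vℕ-other-^ (g q) pr pq (r∉q∷qs ∘ here))
                                                             (vℕ-powProduct-∉ pr pqs (r∉q∷qs ∘ there)) ⟩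
      0                                        ∎
      where open ≡-Reasoning

    vℕ-powProduct-∈ : ∀ {r qs} → Prime r → All Prime qs → Unique qs → r ∈ qs → vℕ r (powProduct qs) ≡ g r
    vℕ-powProduct-∈ {r} {q ∷ qs} pr (pq ∷ pqs) (q∉qs ∷ uniq) r∈q∷qs =
      trans (vℕ-* pr (^-pos (g q) (prime>0 pq)) (powProduct-pos pqs)) (split r∈q∷qs)
      where
      split : r ∈ q ∷ qs → vℕ r (q ^ g q) + vℕ r (powProduct qs) ≡ g r
      split (here refl)  = trans (cong₂ _+_ (vℕ-self-^ (g q) pr)
                                            (vℕ-powProduct-∉ pr pqs λ r∈qs → All.lookup q∉qs r∈qs refl))
                                 (+-identityʳ (g r))
      split (there r∈qs) = cong₂ _+_ (vℕ-other-^ (g q) pr pq λ { refl → All.lookup q∉qs r∈qs refl })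
                                     (vℕ-powProduct-∈ pr pqs uniq r∈qs)

  primeDivisors-prime : ∀ n → All Prime (primeDivisors n)
  primeDivisors-prime n = All.map proj₁ (all-filter (λ q → prime? q ×-dec q ∣? n) (upTo (suc n)))

  primeDivisors-unique : ∀ n → Unique (primeDivisors n)
  primeDivisors-unique n = Unique.filter⁺ (λ q → prime? q ×-dec q ∣? n) (Unique.upTo⁺ (suc n))

  ∈-primeDivisors⁺ : ∀ {n r} → 0 < n → Prime r → r ∣ n → r ∈ primeDivisors n
  ∈-primeDivisors⁺ 0<n pr r∣n =
    ∈-filter⁺ (λ q → prime? q ×-dec q ∣? _) (∈-upTo⁺ (s≤s (∣⇒≤ {{>-nonZero 0<n}} r∣n))) (pr , r∣n)

  ∈-primeDivisors⁻ : ∀ {n r} → r ∈ primeDivisors n → r ∣ n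
  ∈-primeDivisors⁻ {n} r∈ = proj₂ (proj₂ (∈-filter⁻ (λ q → prime? q ×-dec q ∣? n) {xs = upTo (suc n)} r∈))

  primePowerProduct : (ℕ → ℕ) → ℕ → ℕ
  primePowerProduct g n = powProduct g (primeDivisors n)

  primePowerProduct-pos : ∀ g n → 0 < primePowerProduct g n
  primePowerProduct-pos g n = powProduct-pos g (primeDivisors-prime n)

  vℕ-primePowerProduct-∣ : ∀ {r n} g → Prime r → 0 < n → r ∣ n → vℕ r (primePowerProduct g n) ≡ g r
  vℕ-primePowerProduct-∣ {n = n} g pr 0<n r∣n =
    vℕ-powProduct-∈ g pr (primeDivisors-prime n) (primeDivisors-unique n) (∈-primeDivisors⁺ 0<n pr r∣n)

  vℕ-primePowerProduct-∤ : ∀ {r n} g → Prime r → ¬ (r ∣ n) → vℕ r (primePowerProduct g n) ≡ 0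
  vℕ-primePowerProduct-∤ {n = n} g pr r∤n =
    vℕ-powProduct-∉ g pr (primeDivisors-prime n) (r∤n ∘ ∈-primeDivisors⁻)

  rad≡primePowerProduct : ∀ n → rad (+ n) ≡ primePowerProduct (λ _ → 1) n
  rad≡primePowerProduct n =
    cong prodℕ (trans (sym (map-id (primeDivisors n))) (map-cong (sym ∘ *-identityʳ) (primeDivisors n)))

  rad-pos : ∀ n → 0 < rad (+ n)
  rad-pos n = subst (0 <_) (sym (rad≡primePowerProduct n)) (primePowerProduct-pos (λ _ → 1) n)

  vℕ-rad-∣ : ∀ {r n} → Prime r → 0 < n → r ∣ n → vℕ r (rad (+ n)) ≡ 1
  vℕ-rad-∣ {r} {n} pr 0<n r∣n =
    trans (cong (vℕ r) (rad≡primePowerProduct n)) (vℕ-primePowerProduct-∣ (λ _ → 1) pr 0<n r∣n)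

  vℕ-rad-∤ : ∀ {r n} → Prime r → ¬ (r ∣ n) → vℕ r (rad (+ n)) ≡ 0
  vℕ-rad-∤ {r} {n} pr r∤n =
    trans (cong (vℕ r) (rad≡primePowerProduct n)) (vℕ-primePowerProduct-∤ (λ _ → 1) pr r∤n)

  rad-∣ : ∀ {m n} → 0 < m → 0 < n → (∀ r → Prime r → r ∣ m → r ∣ n) → rad (+ m) ∣ n
  rad-∣ {m} {n} 0<m 0<n primes⊆ = ∣-by-vℕ (rad-pos m) 0<n vℕ-rad≤
    where
    vℕ-rad≤ : ∀ r → Prime r → vℕ r (rad (+ m)) ≤ vℕ r n
    vℕ-rad≤ r pr with r ∣? m
    ... | yes r∣m = subst (_≤ vℕ r n) (sym (vℕ-rad-∣ pr 0<m r∣m)) (∣⇒vℕ>0 pr 0<n (primes⊆ r pr r∣m))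
    ... | no  r∤m = subst (_≤ vℕ r n) (sym (vℕ-rad-∤ pr r∤m)) z≤n

  rad-cong : ∀ {m n} → 0 < m → 0 < n →
             (∀ r → Prime r → r ∣ m → r ∣ n) → (∀ r → Prime r → r ∣ n → r ∣ m) → rad (+ m) ≡ rad (+ n)
  rad-cong {m} {n} 0<m 0<n m⊆n n⊆m = ≡-by-vℕ (rad-pos m) (rad-pos n) vℕ-rad≡
    where
    vℕ-rad≡ : ∀ r → Prime r → vℕ r (rad (+ m)) ≡ vℕ r (rad (+ n))
    vℕ-rad≡ r pr with r ∣? m
    ... | yes r∣m = trans (vℕ-rad-∣ pr 0<m r∣m) (sym (vℕ-rad-∣ pr 0<n (m⊆n r pr r∣m)))
    ... | no  r∤m = trans (vℕ-rad-∤ pr r∤m) (sym (vℕ-rad-∤ pr (r∤m ∘ n⊆m r pr)))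

module IntegerFacts where

  open import Data.Nat.Base as ℕ using (ℕ; zero; suc; s≤s)
  import Data.Nat.Properties as ℕ
  import Data.Nat.Divisibility as ℕ
  open import Data.Nat.DivMod using (_%_; _/_; m≡m%n+[m/n]*n; m%n<n; %-distribˡ-*)
  open import Data.Nat.Primality using (Prime)
  open import Data.Nat.Coprimality using (coprime⇒gcd≡1)
  open import Data.Integer.Base using (+_; -[1+_]; _+_; _-_; _*_; _^_; ∣_∣)
  open import Data.Integer.Properties using (abs-*; pos-*; pos-+; +-identityʳ)
  open import Data.Integer.Divisibility using (_∣_; divides)
  open import Data.Integer.Divisibility.Signed as Signed using (∣ᵤ⇒∣; ∣⇒∣ᵤ)
  open import Data.Integer.GCD using (gcd)
  open import Data.Integer.Tactic.RingSolver using (solve-∀)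
  open import Data.Product using (Σ; _×_; _,_)
  open import Data.Sum using (_⊎_; inj₁; inj₂)
  open import Relation.Nullary using (¬_)
  open import Relation.Nullary.Negation using (contradiction)
  open import Relation.Binary.PropositionalEquality
  open Valuation

  abs-^ : ∀ i k → ∣ i ^ k ∣ ≡ ∣ i ∣ ℕ.^ k
  abs-^ i zero    = refl
  abs-^ i (suc k) = trans (abs-* i (i ^ k)) (cong (∣ i ∣ ℕ.*_) (abs-^ i k))

  pos-^ : ∀ m k → + (m ℕ.^ k) ≡ (+ m) ^ k
  pos-^ m zero    = refl
  pos-^ m (suc k) = trans (pos-* m (m ℕ.^ k)) (cong (+ m *_) (pos-^ m k))

  ^-distribʳ-* : ∀ a b k → (a * b) ^ k ≡ a ^ k * b ^ k
  ^-distribʳ-* a b zero    = refl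
  ^-distribʳ-* a b (suc k) = trans (cong (a * b *_) (^-distribʳ-* a b k)) (rearrange a b (a ^ k) (b ^ k))
    where
    rearrange : ∀ w x y z → w * x * (y * z) ≡ w * y * (x * z)
    rearrange = solve-∀

  square≡abs-square : ∀ i → i * i ≡ + (∣ i ∣ ℕ.* ∣ i ∣)
  square≡abs-square (+ n)    = sym (pos-* n n)
  square≡abs-square -[1+ n ] = refl

  SquareResidueMod8 : ℕ → Set
  SquareResidueMod8 c = c ≡ 0 ⊎ c ≡ 1 ⊎ c ≡ 4

  square%8 : ∀ r → r ℕ.< 8 → SquareResidueMod8 ((r ℕ.* r) % 8)
  square%8 0 _ = inj₁ refl
  square%8 1 _ = inj₂ (inj₁ refl)
  square%8 2 _ = inj₂ (inj₂ refl)
  square%8 3 _ = inj₂ (inj₁ refl)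
  square%8 4 _ = inj₁ refl
  square%8 5 _ = inj₂ (inj₁ refl)
  square%8 6 _ = inj₂ (inj₂ refl)
  square%8 7 _ = inj₂ (inj₁ refl)
  square%8 (suc (suc (suc (suc (suc (suc (suc (suc _)))))))) (s≤s (s≤s (s≤s (s≤s (s≤s (s≤s (s≤s (s≤s ()))))))))

  square-mod8 : ∀ t → Σ ℕ λ c → SquareResidueMod8 c × (+ 8) ∣ t * t - + c
  square-mod8 t = c , subst SquareResidueMod8 (sym c≡) (square%8 (T % 8) (m%n<n T 8))
                , divides (T ℕ.* T / 8) (cong ∣_∣ tt-c≡)
    where
    T = ∣ t ∣
    c = T ℕ.* T % 8
    c≡ : c ≡ (T % 8 ℕ.* (T % 8)) % 8
    c≡ = %-distribˡ-* T T 8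
    tt-c≡ : t * t - + c ≡ + (T ℕ.* T / 8 ℕ.* 8)
    tt-c≡ = begin
      t * t - + c                               ≡⟨ cong (_- + c) (square≡abs-square t) ⟩
      + (T ℕ.* T) - + c                         ≡⟨ cong (λ n → + n - + c) (m≡m%n+[m/n]*n (T ℕ.* T) 8) ⟩
      + (c ℕ.+ T ℕ.* T / 8 ℕ.* 8) - + c         ≡⟨ cong (_- + c) (pos-+ c _) ⟩
      + c + + (T ℕ.* T / 8 ℕ.* 8) - + c         ≡⟨ cancel (+ c) _ ⟩
      + (T ℕ.* T / 8 ℕ.* 8)                     ∎
      where
      open ≡-Reasoning
      cancel : ∀ a b → a + b - a ≡ b
      cancel = solve-∀

  square+odd≡0-mod8⇒≡7-mod8 : ∀ t d → (+ 8) ∣ t * t + d → ¬ ((+ 2) ∣ d) → (+ 8) ∣ d - + 7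
  square+odd≡0-mod8⇒≡7-mod8 t d 8∣tt+d 2∤d with c , residue , 8∣tt-c ← square-mod8 t = by-residue residue
    where
    8∣d+c : (+ 8) Signed.∣ d + + c
    8∣d+c = subst ((+ 8) Signed.∣_) (difference (t * t) d (+ c))
              (Signed.∣m∣n⇒∣m-n (∣ᵤ⇒∣ {i = t * t + d} 8∣tt+d) (∣ᵤ⇒∣ {i = t * t - + c} 8∣tt-c))
      where
      difference : ∀ a b k → (a + b) - (a - k) ≡ b + k
      difference = solve-∀
    2∣d+c : (+ 2) Signed.∣ d + + c
    2∣d+c = Signed.∣-trans (Signed.divides (+ 4) refl) 8∣d+c
    by-residue : SquareResidueMod8 c → (+ 8) ∣ d - + 7
    by-residue (inj₁ refl) = contradiction (∣⇒∣ᵤ (subst ((+ 2) Signed.∣_) (+-identityʳ d) 2∣d+c)) 2∤d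
    by-residue (inj₂ (inj₁ refl)) =
      ∣⇒∣ᵤ (subst ((+ 8) Signed.∣_) (shift d) (Signed.∣m∣n⇒∣m-n 8∣d+c Signed.∣-refl))
      where
      shift : ∀ a → a + + 1 - + 8 ≡ a - + 7
      shift = solve-∀
    by-residue (inj₂ (inj₂ refl)) =
      contradiction (∣⇒∣ᵤ (Signed.∣m+n∣n⇒∣m {m = d} 2∣d+c (Signed.divides (+ 2) refl))) 2∤d

  isValuation-of-sum : ∀ {q k} a b →
                       (+ (q ℕ.^ suc k)) ∣ a + b → IsValuation q ∣ b ∣ k → IsValuation q ∣ a ∣ k
  isValuation-of-sum {q} {k} a b q^k+1∣a+b (isValuation q^k∣b q^k+1∤b) = isValuation
    (∣⇒∣ᵤ (Signed.∣m+n∣n⇒∣m {m = a}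
      (∣ᵤ⇒∣ {+ (q ℕ.^ k)} {a + b} (ℕ.∣-trans (^-monoʳ-∣ q (ℕ.n≤1+n k)) q^k+1∣a+b))
      (∣ᵤ⇒∣ {+ (q ℕ.^ k)} {b} q^k∣b)))
    λ q^k+1∣a → q^k+1∤b (∣⇒∣ᵤ (Signed.∣m+n∣m⇒∣n (∣ᵤ⇒∣ {+ (q ℕ.^ suc k)} {a + b} q^k+1∣a+b)
                                                 (∣ᵤ⇒∣ {+ (q ℕ.^ suc k)} {a} q^k+1∣a)))

  no-common-prime⇒gcd≡1 : ∀ i j → 0 ℕ.< ∣ i ∣ →
                          (∀ r → Prime r → r ℕ.∣ ∣ i ∣ → ¬ (r ℕ.∣ ∣ j ∣)) → gcd i j ≡ + 1
  no-common-prime⇒gcd≡1 i j 0<∣i∣ disjoint =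
    cong +_ (coprime⇒gcd≡1 (no-common-prime⇒coprime 0<∣i∣ disjoint))

open import Defs
open import Data.Nat.Base as ℕ using (ℕ; zero; suc; z≤n; z<s; ⌊_/2⌋)
open import Data.Nat.Primality using (Prime; prime[2])
open import Data.Integer using (ℤ; +_; _+_; _-_; _*_; _^_; -_; ∣_∣; _<_; +<+; 0ℤ)
open import Data.Integer.Divisibility using (_∣_)
open import Data.Integer.GCD using (gcd; gcd-comm)
open import Data.Product using (Σ; _×_; _,_)
open import Relation.Binary.PropositionalEquality
open import Function.Base using (_∘_)

module Solution (D x y : ℤ) (p : ℕ) (D≢0 : D ≢ 0ℤ) (x²+D≡yᵖ : x * x + D ≡ y ^ p) (y≢0 : y ≢ 0ℤ)
                (v<p : ∀ q → Prime q → v q D ℕ.+ 1 ℕ.≤ p) where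

  open import Data.Nat.Properties as ℕ using ()
  open import Data.Nat.Divisibility as ℕ using (_∣?_)
  open import Data.Integer.Properties
    using (abs-*; pos-*; *-comm; *-cancelˡ-≡; *-zeroʳ; *-assoc; ∣i∣≡0⇒i≡0; ∣-i∣≡∣i∣)
  open import Data.Integer.Tactic.RingSolver using (solve-∀)
  open import Data.Integer.Divisibility.Signed as Signed using (∣ᵤ⇒∣; ∣⇒∣ᵤ)
  open import Relation.Nullary using (¬_; yes; no)
  open import Relation.Nullary.Negation using (contradiction)
  open Valuation
  open PrimeDivisorProducts
  open IntegerFacts

  2*k≡k+k : ∀ k → 2 ℕ.* k ≡ k ℕ.+ k
  2*k≡k+k k = cong (k ℕ.+_) (ℕ.*-identityˡ k)

  ∣x∣ ∣y∣ ∣D∣ : ℕ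
  ∣x∣ = ∣ x ∣
  ∣y∣ = ∣ y ∣
  ∣D∣ = ∣ D ∣

  0<∣D∣ : 0 ℕ.< ∣D∣
  0<∣D∣ = ℕ.n≢0⇒n>0 (D≢0 ∘ ∣i∣≡0⇒i≡0)

  0<∣y∣ : 0 ℕ.< ∣y∣
  0<∣y∣ = ℕ.n≢0⇒n>0 (y≢0 ∘ ∣i∣≡0⇒i≡0)

  valuation-of-x² : ∀ {r} → Prime r → r ℕ.∣ ∣y∣ → IsValuation r (∣x∣ ℕ.* ∣x∣) (vℕ r ∣D∣)
  valuation-of-x² {r} pr r∣y = subst (λ n → IsValuation r n (vℕ r ∣D∣)) (abs-* x x)
    (isValuation-of-sum (x * x) D r^vD+1∣yᵖ (vℕ-isValuation pr 0<∣D∣))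
    where
    r^vD+1∣yᵖ : r ℕ.^ suc (vℕ r ∣D∣) ℕ.∣ ∣ x * x + D ∣
    r^vD+1∣yᵖ = subst (r ℕ.^ suc (vℕ r ∣D∣) ℕ.∣_) (sym (trans (cong ∣_∣ x²+D≡yᵖ) (abs-^ y p)))
                  (ℕ.∣-trans (^-monoʳ-∣ r (subst (ℕ._≤ p) (ℕ.+-comm _ 1) (v<p r pr))) (^-monoˡ-∣ p r∣y))

  0<∣x∣ : ∀ {r} → Prime r → r ℕ.∣ ∣y∣ → 0 ℕ.< ∣x∣
  0<∣x∣ pr r∣y with ∣x∣ | valuation-of-x² pr r∣y
  ... | zero  | val = contradiction val ¬isValuation[0]
  ... | suc _ | _   = z<s

  vD≡vx+vx : ∀ {r} → Prime r → r ℕ.∣ ∣y∣ → vℕ r ∣D∣ ≡ vℕ r ∣x∣ ℕ.+ vℕ r ∣x∣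
  vD≡vx+vx pr r∣y = trans (sym (vℕ-unique pr (*-pos 0<x 0<x) (valuation-of-x² pr r∣y))) (vℕ-* pr 0<x 0<x)
    where 0<x = 0<∣x∣ pr r∣y

  halfvD : ℕ → ℕ
  halfvD q = ⌊ vℕ q ∣D∣ /2⌋

  d₁ℕ : ℕ
  d₁ℕ = primePowerProduct halfvD ∣y∣

  d₁ : ℤ
  d₁ = + d₁ℕ

  0<d₁ : 0 ℕ.< d₁ℕ
  0<d₁ = primePowerProduct-pos halfvD ∣y∣

  vd₁≡vx : ∀ {r} → Prime r → r ℕ.∣ ∣y∣ → vℕ r d₁ℕ ≡ vℕ r ∣x∣
  vd₁≡vx pr r∣y = trans (vℕ-primePowerProduct-∣ halfvD pr 0<∣y∣ r∣y)
                        (trans (cong ⌊_/2⌋ (vD≡vx+vx pr r∣y)) (sym (ℕ.n≡⌊n+n/2⌋ _)))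

  vd₁≡0 : ∀ {r} → Prime r → ¬ (r ℕ.∣ ∣y∣) → vℕ r d₁ℕ ≡ 0
  vd₁≡0 pr = vℕ-primePowerProduct-∤ halfvD pr

  d₁-prime⇒y-prime : ∀ {r} → Prime r → r ℕ.∣ d₁ℕ → r ℕ.∣ ∣y∣
  d₁-prime⇒y-prime {r} pr r∣d₁ with r ∣? ∣y∣
  ... | yes r∣y = r∣y
  ... | no  r∤y = contradiction r∣d₁ (vℕ≡0⇒∤ pr 0<d₁ (vd₁≡0 pr r∤y))

  vD≡vd₁+vd₁ : ∀ {r} → Prime r → r ℕ.∣ ∣y∣ → vℕ r ∣D∣ ≡ vℕ r d₁ℕ ℕ.+ vℕ r d₁ℕ
  vD≡vd₁+vd₁ pr r∣y = trans (vD≡vx+vx pr r∣y) (sym (cong₂ ℕ._+_ (vd₁≡vx pr r∣y) (vd₁≡vx pr r∣y)))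

  d₁²∣D : d₁ℕ ℕ.* d₁ℕ ℕ.∣ ∣D∣
  d₁²∣D = ∣-by-vℕ (*-pos 0<d₁ 0<d₁) 0<∣D∣ λ r pr →
    subst (ℕ._≤ vℕ r ∣D∣) (sym (vℕ-* pr 0<d₁ 0<d₁)) (vd₁+vd₁≤vD r pr)
    where
    vd₁+vd₁≤vD : ∀ r → Prime r → vℕ r d₁ℕ ℕ.+ vℕ r d₁ℕ ℕ.≤ vℕ r ∣D∣
    vd₁+vd₁≤vD r pr with r ∣? ∣y∣
    ... | yes r∣y = ℕ.≤-reflexive (sym (vD≡vd₁+vd₁ pr r∣y))
    ... | no  r∤y = subst (ℕ._≤ vℕ r ∣D∣) (sym (cong₂ ℕ._+_ (vd₁≡0 pr r∤y) (vd₁≡0 pr r∤y))) z≤n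

  d₁∣x : d₁ℕ ℕ.∣ ∣x∣
  d₁∣x with ∣x∣ ℕ.≟ 0
  ... | yes x≡0 = subst (d₁ℕ ℕ.∣_) (sym x≡0) (d₁ℕ ℕ.∣0)
  ... | no  x≢0 = ∣-by-vℕ 0<d₁ (ℕ.n≢0⇒n>0 x≢0) vd₁≤vx
    where
    vd₁≤vx : ∀ r → Prime r → vℕ r d₁ℕ ℕ.≤ vℕ r ∣x∣
    vd₁≤vx r pr with r ∣? ∣y∣
    ... | yes r∣y = ℕ.≤-reflexive (vd₁≡vx pr r∣y)
    ... | no  r∤y = subst (ℕ._≤ vℕ r ∣x∣) (sym (vd₁≡0 pr r∤y)) z≤n

  rad-d₁∣y : rad d₁ ℕ.∣ ∣y∣
  rad-d₁∣y = rad-∣ 0<d₁ 0<∣y∣ λ _ → d₁-prime⇒y-prime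

  d₂ t s : ℤ
  d₂ = Signed.quotient (∣ᵤ⇒∣ {+ (d₁ℕ ℕ.* d₁ℕ)} {D} d₁²∣D)
  t  = Signed.quotient (∣ᵤ⇒∣ {d₁} {x} d₁∣x)
  s  = Signed.quotient (∣ᵤ⇒∣ {+ rad d₁} {y} rad-d₁∣y)

  D≡d₂d₁² : D ≡ d₂ * + (d₁ℕ ℕ.* d₁ℕ)
  D≡d₂d₁² = Signed._∣_.equality (∣ᵤ⇒∣ {+ (d₁ℕ ℕ.* d₁ℕ)} {D} d₁²∣D)

  x≡d₁t : x ≡ d₁ * t
  x≡d₁t = trans (Signed._∣_.equality (∣ᵤ⇒∣ {d₁} {x} d₁∣x)) (*-comm t d₁)

  y≡rad-d₁·s : y ≡ + rad d₁ * s
  y≡rad-d₁·s = trans (Signed._∣_.equality (∣ᵤ⇒∣ {+ rad d₁} {y} rad-d₁∣y)) (*-comm s (+ rad d₁))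

  s≢0 : s ≢ 0ℤ
  s≢0 s≡0 = y≢0 (trans y≡rad-d₁·s (trans (cong (+ rad d₁ *_) s≡0) (*-zeroʳ (+ rad d₁))))

  D≡d₁d₁d₂ : D ≡ d₁ * d₁ * d₂
  D≡d₁d₁d₂ = trans D≡d₂d₁² (trans (cong (d₂ *_) (pos-* d₁ℕ d₁ℕ)) (*-comm d₂ (d₁ * d₁)))

  ∣D∣≡∣d₂∣d₁² : ∣D∣ ≡ ∣ d₂ ∣ ℕ.* (d₁ℕ ℕ.* d₁ℕ)
  ∣D∣≡∣d₂∣d₁² = trans (cong ∣_∣ D≡d₂d₁²) (abs-* d₂ (+ (d₁ℕ ℕ.* d₁ℕ)))

  0<∣d₂∣ : 0 ℕ.< ∣ d₂ ∣
  0<∣d₂∣ = ℕ.n≢0⇒n>0 λ d₂≡0 →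
    ℕ.>⇒≢ 0<∣D∣ (trans ∣D∣≡∣d₂∣d₁² (cong (ℕ._* (d₁ℕ ℕ.* d₁ℕ)) d₂≡0))

  vd₂≡0 : ∀ {r} → Prime r → r ℕ.∣ ∣y∣ → vℕ r ∣ d₂ ∣ ≡ 0
  vd₂≡0 {r} pr r∣y = ℕ.+-cancelʳ-≡ (vℕ r (d₁ℕ ℕ.* d₁ℕ)) (vℕ r ∣ d₂ ∣) 0 (begin
    vℕ r ∣ d₂ ∣ ℕ.+ vℕ r (d₁ℕ ℕ.* d₁ℕ)  ≡⟨ vℕ-* pr 0<∣d₂∣ (*-pos 0<d₁ 0<d₁) ⟨
    vℕ r (∣ d₂ ∣ ℕ.* (d₁ℕ ℕ.* d₁ℕ))     ≡⟨ cong (vℕ r) ∣D∣≡∣d₂∣d₁² ⟨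
    vℕ r ∣D∣                            ≡⟨ vD≡vd₁+vd₁ pr r∣y ⟩
    vℕ r d₁ℕ ℕ.+ vℕ r d₁ℕ               ≡⟨ vℕ-* pr 0<d₁ 0<d₁ ⟨
    vℕ r (d₁ℕ ℕ.* d₁ℕ)                  ∎)
    where open ≡-Reasoning

  y-prime∤d₂ : ∀ {r} → Prime r → r ℕ.∣ ∣y∣ → ¬ (r ℕ.∣ ∣ d₂ ∣)
  y-prime∤d₂ pr r∣y = vℕ≡0⇒∤ pr 0<∣d₂∣ (vd₂≡0 pr r∣y)

  gcd[d₁,d₂]≡1 : gcd d₁ d₂ ≡ + 1
  gcd[d₁,d₂]≡1 = no-common-prime⇒gcd≡1 d₁ d₂ 0<d₁ λ r pr r∣d₁ →
    y-prime∤d₂ pr (d₁-prime⇒y-prime pr r∣d₁)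

  2vd₁<p : ∀ {r} → Prime r → r ℕ.∣ d₁ℕ → 2 ℕ.* vℕ r d₁ℕ ℕ.< p
  2vd₁<p {r} pr r∣d₁ = subst (ℕ._≤ p) vD+1≡1+2vd₁ (v<p r pr)
    where
    vD+1≡1+2vd₁ : vℕ r ∣D∣ ℕ.+ 1 ≡ suc (2 ℕ.* vℕ r d₁ℕ)
    vD+1≡1+2vd₁ = trans (ℕ.+-comm _ 1) (cong suc
                    (trans (vD≡vd₁+vd₁ pr (d₁-prime⇒y-prime pr r∣d₁)) (sym (2*k≡k+k (vℕ r d₁ℕ)))))

  eExponent : ℕ → ℕ
  eExponent q = p ℕ.∸ 2 ℕ.* vℕ q d₁ℕ

  e : ℕ
  e = eConst p d₁

  0<e : 0 ℕ.< e
  0<e = primePowerProduct-pos eExponent d₁ℕ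

  ve≡ : ∀ {r} → Prime r → r ℕ.∣ d₁ℕ → vℕ r e ≡ p ℕ.∸ 2 ℕ.* vℕ r d₁ℕ
  ve≡ pr = vℕ-primePowerProduct-∣ eExponent pr 0<d₁

  ve≡0 : ∀ {r} → Prime r → ¬ (r ℕ.∣ d₁ℕ) → vℕ r e ≡ 0
  ve≡0 pr = vℕ-primePowerProduct-∤ eExponent pr

  d₁-prime⇒e-prime : ∀ {r} → Prime r → r ℕ.∣ d₁ℕ → r ℕ.∣ e
  d₁-prime⇒e-prime pr r∣d₁ =
    vℕ>0⇒∣ pr 0<e (subst (0 ℕ.<_) (sym (ve≡ pr r∣d₁)) (ℕ.m<n⇒0<n∸m (2vd₁<p pr r∣d₁)))

  e-prime⇒d₁-prime : ∀ {r} → Prime r → r ℕ.∣ e → r ℕ.∣ d₁ℕ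
  e-prime⇒d₁-prime {r} pr r∣e with r ∣? d₁ℕ
  ... | yes r∣d₁ = r∣d₁
  ... | no  r∤d₁ = contradiction r∣e (vℕ≡0⇒∤ pr 0<e (ve≡0 pr r∤d₁))

  radᵖ≡d₁²e : rad d₁ ℕ.^ p ≡ d₁ℕ ℕ.* d₁ℕ ℕ.* e
  radᵖ≡d₁²e = ≡-by-vℕ (^-pos p (rad-pos d₁ℕ)) (*-pos (*-pos 0<d₁ 0<d₁) 0<e) λ r pr → begin
    vℕ r (rad d₁ ℕ.^ p)                          ≡⟨ vℕ-^ p pr (rad-pos d₁ℕ) ⟩
    p ℕ.* vℕ r (rad d₁)                          ≡⟨ by-cases r pr ⟩
    vℕ r d₁ℕ ℕ.+ vℕ r d₁ℕ ℕ.+ vℕ r e             ≡⟨ cong (ℕ._+ vℕ r e) (vℕ-* pr 0<d₁ 0<d₁) ⟨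
    vℕ r (d₁ℕ ℕ.* d₁ℕ) ℕ.+ vℕ r e                ≡⟨ vℕ-* pr (*-pos 0<d₁ 0<d₁) 0<e ⟨
    vℕ r (d₁ℕ ℕ.* d₁ℕ ℕ.* e)                     ∎
    where
    open ≡-Reasoning
    by-cases : ∀ r → Prime r → p ℕ.* vℕ r (rad d₁) ≡ vℕ r d₁ℕ ℕ.+ vℕ r d₁ℕ ℕ.+ vℕ r e
    by-cases r pr with r ∣? d₁ℕ
    ... | yes r∣d₁ = begin
      p ℕ.* vℕ r (rad d₁)                         ≡⟨ cong (p ℕ.*_) (vℕ-rad-∣ pr 0<d₁ r∣d₁) ⟩
      p ℕ.* 1                                     ≡⟨ ℕ.*-identityʳ p ⟩
      p                                           ≡⟨ ℕ.m+[n∸m]≡n (ℕ.<⇒≤ (2vd₁<p pr r∣d₁)) ⟨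
      2 ℕ.* vℕ r d₁ℕ ℕ.+ (p ℕ.∸ 2 ℕ.* vℕ r d₁ℕ)   ≡⟨ cong₂ ℕ._+_ (2*k≡k+k (vℕ r d₁ℕ)) (sym (ve≡ pr r∣d₁)) ⟩
      vℕ r d₁ℕ ℕ.+ vℕ r d₁ℕ ℕ.+ vℕ r e            ∎
    ... | no  r∤d₁ = begin
      p ℕ.* vℕ r (rad d₁)                         ≡⟨ cong (p ℕ.*_) (vℕ-rad-∤ pr r∤d₁) ⟩
      p ℕ.* 0                                     ≡⟨ ℕ.*-zeroʳ p ⟩
      0                                           ≡⟨ cong₂ ℕ._+_ (cong₂ ℕ._+_ v₀ v₀) (ve≡0 pr r∤d₁) ⟨
      vℕ r d₁ℕ ℕ.+ vℕ r d₁ℕ ℕ.+ vℕ r e            ∎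
      where v₀ = ∤⇒vℕ≡0 pr 0<d₁ r∤d₁

  t²+d₂≡esᵖ : t * t + d₂ ≡ + e * s ^ p
  t²+d₂≡esᵖ = *-cancelˡ-≡ (+ (d₁ℕ ℕ.* d₁ℕ)) (t * t + d₂) (+ e * s ^ p)
                {{ℕ.>-nonZero (*-pos 0<d₁ 0<d₁)}} (begin
    + (d₁ℕ ℕ.* d₁ℕ) * (t * t + d₂)     ≡⟨ cong (_* (t * t + d₂)) (pos-* d₁ℕ d₁ℕ) ⟩
    d₁ * d₁ * (t * t + d₂)             ≡⟨ expand d₁ t d₂ ⟩
    d₁ * t * (d₁ * t) + d₁ * d₁ * d₂   ≡⟨ cong₂ _+_ (cong₂ _*_ x≡d₁t x≡d₁t) D≡d₁d₁d₂ ⟨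
    x * x + D                          ≡⟨ x²+D≡yᵖ ⟩
    y ^ p                              ≡⟨ cong (_^ p) y≡rad-d₁·s ⟩
    (+ rad d₁ * s) ^ p                 ≡⟨ ^-distribʳ-* (+ rad d₁) s p ⟩
    (+ rad d₁) ^ p * s ^ p             ≡⟨ cong (_* s ^ p) (pos-^ (rad d₁) p) ⟨
    + (rad d₁ ℕ.^ p) * s ^ p           ≡⟨ cong (λ n → + n * s ^ p) radᵖ≡d₁²e ⟩
    + (d₁ℕ ℕ.* d₁ℕ ℕ.* e) * s ^ p      ≡⟨ cong (_* s ^ p) (pos-* (d₁ℕ ℕ.* d₁ℕ) e) ⟩
    + (d₁ℕ ℕ.* d₁ℕ) * + e * s ^ p      ≡⟨ *-assoc (+ (d₁ℕ ℕ.* d₁ℕ)) (+ e) (s ^ p) ⟩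
    + (d₁ℕ ℕ.* d₁ℕ) * (+ e * s ^ p)    ∎)
    where
    open ≡-Reasoning
    expand : ∀ d t c → d * d * (t * t + c) ≡ d * t * (d * t) + d * d * c
    expand = solve-∀

  e∣t²+d₂ : ∀ {m} → m ℕ.∣ e → m ℕ.∣ ∣ t * t + d₂ ∣
  e∣t²+d₂ m∣e =
    subst (_ ℕ.∣_) (sym (trans (cong ∣_∣ t²+d₂≡esᵖ) (abs-* (+ e) (s ^ p)))) (ℕ.∣m⇒∣m*n _ m∣e)

  common-prime-of-t-d₂⇒y-prime : ∀ {r} → Prime r → r ℕ.∣ ∣ d₂ ∣ → r ℕ.∣ ∣ t ∣ → r ℕ.∣ ∣y∣
  common-prime-of-t-d₂⇒y-prime {r} pr r∣d₂ r∣t =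
    prime∣^⇒∣ p pr (subst (r ℕ.∣_) (trans (cong ∣_∣ x²+D≡yᵖ) (abs-^ y p))
      (∣⇒∣ᵤ (Signed.∣m∣n⇒∣m+n (∣ᵤ⇒∣ {+ r} {x * x} r∣x²) (∣ᵤ⇒∣ {+ r} {D} r∣D))))
    where
    r∣x : r ℕ.∣ ∣x∣
    r∣x = subst (r ℕ.∣_) (sym (trans (cong ∣_∣ x≡d₁t) (abs-* d₁ t))) (ℕ.∣n⇒∣m*n d₁ℕ r∣t)
    r∣x² : r ℕ.∣ ∣ x * x ∣
    r∣x² = subst (r ℕ.∣_) (sym (abs-* x x)) (ℕ.∣m⇒∣m*n ∣x∣ r∣x)
    r∣D : r ℕ.∣ ∣D∣
    r∣D = subst (r ℕ.∣_) (sym ∣D∣≡∣d₂∣d₁²) (ℕ.∣m⇒∣m*n _ r∣d₂)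

  gcd[t,d₂]≡1 : gcd t d₂ ≡ + 1
  gcd[t,d₂]≡1 = trans (gcd-comm t d₂) (no-common-prime⇒gcd≡1 d₂ t 0<∣d₂∣ λ r pr r∣d₂ r∣t →
                  y-prime∤d₂ pr (common-prime-of-t-d₂⇒y-prime pr r∣d₂ r∣t) r∣d₂)

  legendre[-d₂/q]≡1 : ∀ q → Prime q → q ≢ 2 → (+ q) ∣ d₁ → LegendreIsOne (- d₂) q
  legendre[-d₂/q]≡1 q pq _ q∣d₁ = q∤-d₂ , t , q∣t²+d₂
    where
    q∤-d₂ : ¬ ((+ q) ∣ - d₂)
    q∤-d₂ q∣-d₂ =
      y-prime∤d₂ pq (d₁-prime⇒y-prime pq q∣d₁) (subst (q ℕ.∣_) (∣-i∣≡∣i∣ d₂) q∣-d₂)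
    q∣t²+d₂ : (+ q) ∣ t * t - - d₂
    q∣t²+d₂ = subst (λ i → q ℕ.∣ ∣ i ∣) (sym (minus-neg t d₂)) (e∣t²+d₂ (d₁-prime⇒e-prime pq q∣d₁))
      where
      minus-neg : ∀ a b → a * a - - b ≡ a * a + b
      minus-neg = solve-∀

  2vd₁≤p : ∀ q → Prime q → (+ q) ∣ d₁ → 2 ℕ.* v q d₁ ℕ.≤ p
  2vd₁≤p q pq q∣d₁ = ℕ.<⇒≤ (2vd₁<p pq q∣d₁)

  rad-e≡rad-d₁ : rad (+ e) ≡ rad d₁
  rad-e≡rad-d₁ = rad-cong 0<e 0<d₁ (λ _ → e-prime⇒d₁-prime) (λ _ → d₁-prime⇒e-prime)

  d₁-even⇒d₂≡7-mod8 : ((Σ ℕ λ k → v 2 D ≡ 2 ℕ.* k) → v 2 D ℕ.+ 7 ℕ.≤ p) →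
                      (+ 2) ∣ d₁ → (+ 8) ∣ d₂ - + 7
  d₁-even⇒d₂≡7-mod8 v₂-even⇒v₂+7≤p 2∣d₁ =
    square+odd≡0-mod8⇒≡7-mod8 t d₂ (e∣t²+d₂ 8∣e) (y-prime∤d₂ prime[2] 2∣y)
    where
    2∣y = d₁-prime⇒y-prime prime[2] 2∣d₁
    vD≡2vd₁ : v 2 D ≡ 2 ℕ.* vℕ 2 d₁ℕ
    vD≡2vd₁ = trans (vD≡vd₁+vd₁ prime[2] 2∣y) (sym (2*k≡k+k (vℕ 2 d₁ℕ)))
    2vd₁+7≤p : 2 ℕ.* vℕ 2 d₁ℕ ℕ.+ 7 ℕ.≤ p
    2vd₁+7≤p = subst (λ k → k ℕ.+ 7 ℕ.≤ p) vD≡2vd₁ (v₂-even⇒v₂+7≤p (vℕ 2 d₁ℕ , vD≡2vd₁))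
    3≤ve : 3 ℕ.≤ vℕ 2 e
    3≤ve = subst (3 ℕ.≤_) (sym (ve≡ prime[2] 2∣d₁))
             (ℕ.≤-trans (ℕ.m≤m+n 3 4) (ℕ.m+n≤o⇒m≤o∸n 7 (subst (ℕ._≤ p) (ℕ.+-comm _ 7) 2vd₁+7≤p)))
    8∣e : 8 ℕ.∣ e
    8∣e = ≤vℕ⇒^∣ prime[2] 0<e 3≤ve

lemma4p1 : (D x y : ℤ) (p : ℕ) → D ≢ 0ℤ → Prime p → 3 ℕ.≤ p
    → x * x + D ≡ y ^ p → y ≢ 0ℤ → 7 ℕ.≤ p
    → (∀ q → Prime q → v q D ℕ.+ 1 ℕ.≤ p)
    → ((Σ ℕ λ k → v 2 D ≡ 2 ℕ.* k) → v 2 D ℕ.+ 7 ℕ.≤ p)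
    → Σ ℤ λ d₁ → Σ ℤ λ d₂ →
        (0ℤ < d₁)
        × (D ≡ d₁ * d₁ * d₂)
        × (gcd d₁ d₂ ≡ + 1)
        × (∀ q → Prime q → q ≢ 2 → (+ q) ∣ d₁ → LegendreIsOne (- d₂) q)
        × ((+ 2) ∣ d₁ → (+ 8) ∣ (d₂ - + 7))
        × (Σ ℤ λ s → Σ ℤ λ t →
            (x ≡ d₁ * t)
            × (y ≡ (+ rad d₁) * s)
            × (t * t + d₂ ≡ (+ eConst p d₁) * s ^ p)
            × (gcd t d₂ ≡ + 1)
            × (s ≢ 0ℤ)
            × (∀ q → Prime q → (+ q) ∣ d₁ → 2 ℕ.* v q d₁ ℕ.≤ p)
            × (rad (+ eConst p d₁) ≡ rad d₁))
lemma4p1 D x y p D≢0 _ _ x²+D≡yᵖ y≢0 _ v<p v₂-even⇒v₂+7≤p =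
  d₁ , d₂ , +<+ 0<d₁ , D≡d₁d₁d₂ , gcd[d₁,d₂]≡1 , legendre[-d₂/q]≡1 ,
  d₁-even⇒d₂≡7-mod8 v₂-even⇒v₂+7≤p ,
  s , t , x≡d₁t , y≡rad-d₁·s , t²+d₂≡esᵖ , gcd[t,d₂]≡1 , s≢0 , 2vd₁≤p , rad-e≡rad-d₁
  where open Solution D x y p D≢0 x²+D≡yᵖ y≢0 v<p
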